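{- For every positive integer $n$, the graph $H_{4n+1,4n+4}+K_1$ is $(8n^2+14n+6,1)$-distance antimagic.
   Context: $H_{4n+1,4n+4}$ has vertices $v_0,\dots,v_{4n+3}$ (indices mod $4n+4$): $v_i\sim v_j$ iff $i\ne j$ and $j\equiv i+t$ for some $1\le|t|\le 2n$, or $j\equiv i+2n+2$. $G+K_1$ is the join of $G$ with one new vertex adjacent to all vertices of $G$. For integers $a$ and $d\ge 0$, an $(a,d)$-distance antimagic labeling of a graph on $N$ vertices is a bijection $f:V\to\{1,\dots,N\}$ such that the set of vertex weights $\{\sum_{v\in N(u)}f(v)\}$ equals $\{a,a+d,\dots,a+(N-1)d\}$. -}

module Defs where

open import Data.Nat using (ℕ; zero; suc; _+_; _*_; _∸_; _≤ᵇ_; _≡ᵇ_; NonZero)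
open import Data.Nat.DivMod using (_%_)
open import Data.Bool using (Bool; true; false; _∧_; _∨_; not; if_then_else_)
open import Data.Fin using (Fin; zero; suc; toℕ)
open import Data.List using (List; map; allFin)
open import Data.Nat.ListAction using (sum)
open import Data.Integer using (ℤ; +_)
open import Data.Product using (Σ; ∃; _×_)
open import Function.Definitions using (Bijective)
open import Relation.Binary.PropositionalEquality using (_≡_)

Graph : ℕ → Set
Graph N = Fin N → Fin N → Bool

-- The circulant graph H_{4n+1,4n+4}: vertices v_0..v_{4n+3} (v_i = Fin element i).
-- With m = 4n+4 and δ = (j - i) mod m  (computed as (m + j - i) % m),
-- v_i ~ v_j  iff  i ≠ j and  ( 1 ≤ δ ≤ 2n          -- j ≡ i + t, 1 ≤ t ≤ 2n
--                           ∨ m - 2n ≤ δ ≤ m - 1   -- j ≡ i + t, -2n ≤ t ≤ -1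
--                           ∨ δ = 2n + 2 ).        -- j ≡ i + 2n + 2
H : (n : ℕ) → Graph (4 * n + 4)
H n i j =
  not (toℕ i ≡ᵇ toℕ j) ∧
  ( ((1 ≤ᵇ δ) ∧ (δ ≤ᵇ 2 * n))
  ∨ (((m ∸ 2 * n) ≤ᵇ δ) ∧ (δ ≤ᵇ (m ∸ 1)))
  ∨ (δ ≡ᵇ (2 * n + 2)) )
  where
  m : ℕ
  m = 4 * n + 4
  δ : ℕ
  δ = ((m + toℕ j) ∸ toℕ i) % suc (4 * n + 3)   -- suc (4n+3) = m, written so NonZero is found

join-K1 : ∀ {N} → Graph N → Graph (suc N)
join-K1 G zero    zero    = false
join-K1 G zero    (suc v) = true
join-K1 G (suc u) zero    = true
join-K1 G (suc u) (suc v) = G u v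

label : ∀ {N} → (Fin N → Fin N) → Fin N → ℕ
label f v = suc (toℕ (f v))

weight : ∀ {N} → Graph N → (Fin N → Fin N) → Fin N → ℕ
weight {N} G f u = sum (map (λ v → if G u v then label f v else 0) (allFin N))

IsDistanceAntimagicLabeling : ∀ {N} → Graph N → ℤ → ℕ → (Fin N → Fin N) → Set
IsDistanceAntimagicLabeling {N} G a d f =
  Bijective _≡_ _≡_ f
  × (∀ (u : Fin N) → ∃ λ (i : Fin N) → + weight G f u ≡ a Data.Integer.+ + (toℕ i * d))
  × (∀ (i : Fin N) → ∃ λ (u : Fin N) → + weight G f u ≡ a Data.Integer.+ + (toℕ i * d))

DistanceAntimagic : ∀ {N} → Graph N → ℤ → ℕ → Set
DistanceAntimagic {N} G a d = ∃ λ (f : Fin N → Fin N) → IsDistanceAntimagicLabeling G a d f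

module Submission where

-- The non-neighbours of v_i in H_{4n+1,4n+4} are v_i, v_{i+2n+1} and v_{i+2n+3} = v_{i-(2n+1)}, so the
-- complement of H is the cycle generated by the step 2n+1.  Since (2n+1)² = 1 + n(4n+4), multiplication
-- by 2n+1 is an involution of ℤ/(4n+4) carrying this cycle onto the standard cycle 0, 1, …, 4n+3.  On the
-- standard cycle put λ(2j) = j and λ(2j+1) = 4n+3-j; the sums of λ over closed neighbourhoods then run
-- exactly through 4n+3, …, 8n+6.  Label v_i by 1 + λ((2n+1)i mod 4n+4) and the apex by 4n+5: the weight
-- of v_i is the apex label plus the sum of all other labels minus the three labels of its closed
-- neighbourhood in the cycle, so with a = 8n²+14n+6 the weights of the v_i are a, …, a+4n+3 and the apex
-- has weight a+4n+4.

open import Data.Bool using (Bool; true; false; not; _∧_; if_then_else_)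
open import Data.Bool.Properties using (∧-zeroʳ)
open import Data.Fin using (Fin; zero; suc; toℕ; fromℕ; fromℕ<; inject₁)
import Data.Fin as Fin
open import Data.Fin.Permutation using (Permutation′; permutation; _⟨$⟩ʳ_)
open import Data.Fin.Properties using (toℕ<n; toℕ-fromℕ; toℕ-fromℕ<; toℕ-inject₁; toℕ-injective)
import Data.Integer as ℤ
open import Data.List using (map; allFin; tabulate)
open import Data.List.Properties using (map-tabulate)
open import Data.Nat
import Data.Nat.ListAction as List
open import Data.Nat.DivMod
open import Data.Nat.Properties
open import Data.Nat.Tactic.RingSolver using (solve-∀)
open import Algebra.Properties.CommutativeMonoid.Sum +-0-commutativeMonoid
  using (sum-syntax; sum-cong-≗; ∑-distrib-+; sum-permute; sum-replicate-zero; sum-init-last)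
open import Data.Parity.Base using (Parity; 0ℙ; 1ℙ)
open import Data.Product using (∃-syntax; Σ-syntax; _×_; _,_)
open import Data.Sum using (_⊎_; inj₁; inj₂)
open import Data.Sum.Function.Propositional using (_⊎-⇔_)
open import Function using (_∘_; _⇔_; mk⇔; Equivalence; Bijection)
open import Function.Construct.Composition using (_⇔-∘_)
open import Function.Definitions using (Bijective)
open import Function.Properties.Inverse using (Inverse⇒Bijection)
open import Relation.Binary.Definitions using (tri<; tri≈; tri>)
open import Relation.Binary.PropositionalEquality
open import Relation.Nullary using (¬_; Dec; yes; no; does; _×-dec_; _⊎-dec_; contradiction)
open import Relation.Nullary.Decidable using (dec-true; dec-false)

open import Defs

sum-map-allFin : ∀ {N} (g : Fin N → ℕ) → List.sum (map g (allFin N)) ≡ ∑[ i < N ] g i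
sum-map-allFin {N} g = trans (cong List.sum (map-tabulate (λ i → i) g)) (sum-tabulate g)
  where
  sum-tabulate : ∀ {N} (g : Fin N → ℕ) → List.sum (tabulate g) ≡ ∑[ i < N ] g i
  sum-tabulate {zero}  g = refl
  sum-tabulate {suc N} g = cong (g zero +_) (sum-tabulate (λ i → g (suc i)))

onlyAt : ∀ {N} → Fin N → (Fin N → ℕ) → Fin N → ℕ
onlyAt p h v = if does (v Fin.≟ p) then h v else 0

onlyAt-self : ∀ {N} (p : Fin N) (h : Fin N → ℕ) → onlyAt p h p ≡ h p
onlyAt-self p h = cong (if_then h p else 0) (dec-true (p Fin.≟ p) refl)

onlyAt-other : ∀ {N} {p v : Fin N} (h : Fin N → ℕ) → v ≢ p → onlyAt p h v ≡ 0
onlyAt-other {p = p} {v} h v≢p = cong (if_then h v else 0) (dec-false (v Fin.≟ p) v≢p)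

∑-onlyAt : ∀ {N} (p : Fin N) (h : Fin N → ℕ) → ∑[ v < N ] onlyAt p h v ≡ h p
∑-onlyAt {suc N} zero    h = trans (cong (h zero +_) (sum-replicate-zero N)) (+-identityʳ (h zero))
∑-onlyAt {suc N} (suc p) h = ∑-onlyAt p (λ v → h (suc v))

∑-split : ∀ {N} (b : Fin N → Bool) (h : Fin N → ℕ) →
          ∑[ v < N ] (if b v then h v else 0) + ∑[ v < N ] (if b v then 0 else h v) ≡ ∑[ v < N ] h v
∑-split {N} b h = trans (sym (∑-distrib-+ {N} _ _)) (sum-cong-≗ split)
  where
  split : ∀ v → (if b v then h v else 0) + (if b v then 0 else h v) ≡ h v
  split v with b v
  ... | true  = +-identityʳ (h v)
  ... | false = refl

∑-suc-toℕ : ∀ N → 2 * ∑[ i < N ] suc (toℕ i) ≡ N * suc N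
∑-suc-toℕ zero    = refl
∑-suc-toℕ (suc N) = begin
  2 * ∑[ i < suc N ] suc (toℕ i)
    ≡⟨ cong (2 *_) (sum-init-last {N} (λ i → suc (toℕ i))) ⟩
  2 * (∑[ i < N ] suc (toℕ (inject₁ i)) + suc (toℕ (fromℕ N)))
    ≡⟨ cong₂ (λ s t → 2 * (s + suc t))
             (sum-cong-≗ {N} (λ i → cong suc (toℕ-inject₁ i))) (toℕ-fromℕ N) ⟩
  2 * (∑[ i < N ] suc (toℕ i) + suc N)
    ≡⟨ *-distribˡ-+ 2 (∑[ i < N ] suc (toℕ i)) (suc N) ⟩
  2 * ∑[ i < N ] suc (toℕ i) + 2 * suc N
    ≡⟨ cong (_+ 2 * suc N) (∑-suc-toℕ N) ⟩
  N * suc N + 2 * suc N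
    ≡⟨ step N ⟩
  suc N * suc (suc N) ∎
  where
  open ≡-Reasoning
  step : ∀ N → N * suc N + 2 * suc N ≡ suc N * suc (suc N)
  step = solve-∀

∑-outside-three : ∀ {N} (b : Fin N → Bool) (h : Fin N → ℕ) {p q r : Fin N} →
                  p ≢ q → p ≢ r → q ≢ r →
                  (∀ v → b v ≡ false ⇔ (v ≡ p ⊎ v ≡ q ⊎ v ≡ r)) →
                  ∑[ v < N ] (if b v then 0 else h v) ≡ h p + h q + h r
∑-outside-three {N} b h {p} {q} {r} p≢q p≢r q≢r outside = begin
  ∑[ v < N ] (if b v then 0 else h v)
    ≡⟨ sum-cong-≗ {N} pointwise ⟩
  ∑[ v < N ] (onlyAt p h v + onlyAt q h v + onlyAt r h v)
    ≡⟨ ∑-distrib-+ {N} (λ v → onlyAt p h v + onlyAt q h v) (onlyAt r h) ⟩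
  ∑[ v < N ] (onlyAt p h v + onlyAt q h v) + ∑[ v < N ] onlyAt r h v
    ≡⟨ cong (_+ ∑[ v < N ] onlyAt r h v) (∑-distrib-+ {N} (onlyAt p h) (onlyAt q h)) ⟩
  ∑[ v < N ] onlyAt p h v + ∑[ v < N ] onlyAt q h v + ∑[ v < N ] onlyAt r h v
    ≡⟨ cong₂ _+_ (cong₂ _+_ (∑-onlyAt p h) (∑-onlyAt q h)) (∑-onlyAt r h) ⟩
  h p + h q + h r ∎
  where
  open ≡-Reasoning
  pointwise : ∀ v → (if b v then 0 else h v) ≡ onlyAt p h v + onlyAt q h v + onlyAt r h v
  pointwise v with b v in bv
  ... | true = sym (cong₂ _+_ (cong₂ _+_ (onlyAt-other h (excluded inj₁))
                                        (onlyAt-other h (excluded (inj₂ ∘ inj₁))))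
                              (onlyAt-other h (excluded (inj₂ ∘ inj₂))))
    where
    excluded : ∀ {w} → (v ≡ w → v ≡ p ⊎ v ≡ q ⊎ v ≡ r) → v ≢ w
    excluded into v≡w with () ← trans (sym bv) (Equivalence.from (outside v) (into v≡w))
  ... | false with Equivalence.to (outside v) bv
  ... | inj₁ refl =
    sym (trans (cong₂ _+_ (cong₂ _+_ (onlyAt-self p h) (onlyAt-other h p≢q)) (onlyAt-other h p≢r))
               (trans (+-identityʳ _) (+-identityʳ _)))
  ... | inj₂ (inj₁ refl) =
    sym (trans (cong₂ _+_ (cong₂ _+_ (onlyAt-other h (p≢q ∘ sym)) (onlyAt-self q h)) (onlyAt-other h q≢r))
               (+-identityʳ _))
  ... | inj₂ (inj₂ refl) =
    sym (cong₂ _+_ (cong₂ _+_ (onlyAt-other h (p≢r ∘ sym)) (onlyAt-other h (q≢r ∘ sym)))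
                   (onlyAt-self r h))

weight-join-apex : ∀ {N} (G : Graph N) (f : Fin (suc N) → Fin (suc N)) →
                   weight (join-K1 G) f zero ≡ ∑[ v < N ] label f (suc v)
weight-join-apex G f = sum-map-allFin (λ v → if join-K1 G zero v then label f v else 0)

weight-join-vertex : ∀ {N} (G : Graph N) (f : Fin (suc N) → Fin (suc N)) u →
                     weight (join-K1 G) f (suc u) ≡
                     label f zero + ∑[ v < N ] (if G u v then label f (suc v) else 0)
weight-join-vertex G f u = sum-map-allFin (λ v → if join-K1 G (suc u) v then label f v else 0)

offsets⇒isDistanceAntimagicLabeling :
  ∀ {N} (G : Graph N) {f : Fin N → Fin N} a → Bijective _≡_ _≡_ f →
  (∀ u → ∃[ i ] weight G f u ≡ a + toℕ i) → (∀ i → ∃[ u ] weight G f u ≡ a + toℕ i) →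
  IsDistanceAntimagicLabeling G (ℤ.+ a) 1 f
offsets⇒isDistanceAntimagicLabeling G a bijective offset vertexAt =
  bijective ,
  (λ u → let (i , w≡) = offset u in i , cong ℤ.+_ (trans w≡ (cong (a +_) (sym (*-identityʳ (toℕ i)))))) ,
  (λ i → let (u , w≡) = vertexAt i in u , cong ℤ.+_ (trans w≡ (cong (a +_) (sym (*-identityʳ (toℕ i))))))

record BijectiveBelow (N : ℕ) (φ : ℕ → ℕ) : Set where
  field
    inverse   : ℕ → ℕ
    φ-<       : ∀ {x} → x < N → φ x < N
    inverse-< : ∀ {y} → y < N → inverse y < N
    inverse∘φ : ∀ {x} → x < N → inverse (φ x) ≡ x
    φ∘inverse : ∀ {y} → y < N → φ (inverse y) ≡ y

involution⇒bijectiveBelow : ∀ {N φ} → (∀ {x} → x < N → φ x < N) →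
                            (∀ {x} → x < N → φ (φ x) ≡ x) → BijectiveBelow N φ
involution⇒bijectiveBelow {φ = φ} φ-< φ∘φ = record
  { inverse = φ ; φ-< = φ-< ; inverse-< = φ-< ; inverse∘φ = φ∘φ ; φ∘inverse = φ∘φ }

bijectiveBelow-∘ : ∀ {N φ ψ} → BijectiveBelow N φ → BijectiveBelow N ψ → BijectiveBelow N (φ ∘ ψ)
bijectiveBelow-∘ {φ = φ} {ψ} bφ bψ = record
  { inverse   = Bψ.inverse ∘ Bφ.inverse
  ; φ-<       = Bφ.φ-< ∘ Bψ.φ-<
  ; inverse-< = Bψ.inverse-< ∘ Bφ.inverse-<
  ; inverse∘φ = λ x<N → trans (cong Bψ.inverse (Bφ.inverse∘φ (Bψ.φ-< x<N))) (Bψ.inverse∘φ x<N)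
  ; φ∘inverse = λ y<N → trans (cong φ (Bψ.φ∘inverse (Bφ.inverse-< y<N))) (Bφ.φ∘inverse y<N)
  }
  where
  module Bφ = BijectiveBelow bφ
  module Bψ = BijectiveBelow bψ

extendTop : ℕ → (ℕ → ℕ) → ℕ → ℕ
extendTop N φ zero    = N
extendTop N φ (suc x) = φ x

bijectiveBelow-extendTop : ∀ {N φ} → BijectiveBelow N φ → BijectiveBelow (suc N) (extendTop N φ)
bijectiveBelow-extendTop {N} {φ} bφ = record
  { inverse   = inverse
  ; φ-<       = extend-<
  ; inverse-< = inverse-<
  ; inverse∘φ = inverse∘extend
  ; φ∘inverse = extend∘inverse
  }
  where
  module Bφ = BijectiveBelow bφ

  inverse : ℕ → ℕ
  inverse y with y <? N
  ... | yes _ = suc (Bφ.inverse y)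
  ... | no  _ = 0

  inverse-below : ∀ {y} → y < N → inverse y ≡ suc (Bφ.inverse y)
  inverse-below {y} y<N with y <? N
  ... | yes _   = refl
  ... | no  y≮N = contradiction y<N y≮N

  inverse-N : inverse N ≡ 0
  inverse-N with N <? N
  ... | yes N<N = contradiction N<N (n≮n N)
  ... | no  _   = refl

  extend-< : ∀ {x} → x < suc N → extendTop N φ x < suc N
  extend-< {zero}  _     = n<1+n N
  extend-< {suc x} x<sN = m<n⇒m<1+n (Bφ.φ-< (s≤s⁻¹ x<sN))

  inverse-< : ∀ {y} → y < suc N → inverse y < suc N
  inverse-< {y} _ with y <? N
  ... | yes y<N = s≤s (Bφ.inverse-< y<N)
  ... | no  _   = s≤s z≤n

  inverse∘extend : ∀ {x} → x < suc N → inverse (extendTop N φ x) ≡ x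
  inverse∘extend {zero}  _     = inverse-N
  inverse∘extend {suc x} x<sN =
    trans (inverse-below (Bφ.φ-< (s≤s⁻¹ x<sN))) (cong suc (Bφ.inverse∘φ (s≤s⁻¹ x<sN)))

  extend∘inverse : ∀ {y} → y < suc N → extendTop N φ (inverse y) ≡ y
  extend∘inverse {y} y<sN with y <? N
  ... | yes y<N = Bφ.φ∘inverse y<N
  ... | no  y≮N = ≤-antisym (≮⇒≥ y≮N) (s≤s⁻¹ y<sN)

module _ {N : ℕ} {φ : ℕ → ℕ} (bφ : BijectiveBelow N φ) where

  open BijectiveBelow bφ

  toPermutation : Permutation′ N
  toPermutation = permutation to from to∘from from∘to
    where
    to from : Fin N → Fin N
    to   i = fromℕ< (φ-< (toℕ<n i))
    from i = fromℕ< (inverse-< (toℕ<n i))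
    to∘from : ∀ i → to (from i) ≡ i
    to∘from i = toℕ-injective
      (trans (toℕ-fromℕ< _) (trans (cong φ (toℕ-fromℕ< _)) (φ∘inverse (toℕ<n i))))
    from∘to : ∀ i → from (to i) ≡ i
    from∘to i = toℕ-injective
      (trans (toℕ-fromℕ< _) (trans (cong inverse (toℕ-fromℕ< _)) (inverse∘φ (toℕ<n i))))

  toℕ-toPermutation : ∀ i → toℕ (toPermutation ⟨$⟩ʳ i) ≡ φ (toℕ i)
  toℕ-toPermutation i = toℕ-fromℕ< _

data Half : ℕ → Set where
  twice   : ∀ j → Half (j + j)
  twice+1 : ∀ j → Half (suc (j + j))

half : ∀ p → Half p
half zero          = twice zero
half (suc zero)    = twice+1 zero
half (suc (suc p)) with half p
... | twice j   = subst Half (cong suc (+-suc j j)) (twice (suc j))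
... | twice+1 j = subst Half (cong (λ k → suc (suc k)) (+-suc j j)) (twice+1 (suc j))

parity-twice : ∀ j → parity (j + j) ≡ 0ℙ
parity-twice zero    = refl
parity-twice (suc j) = trans (cong (λ k → parity (suc k)) (+-suc j j)) (parity-twice j)

parity-twice+1 : ∀ j → parity (suc (j + j)) ≡ 1ℙ
parity-twice+1 zero    = refl
parity-twice+1 (suc j) = trans (cong (λ k → parity (suc (suc k))) (+-suc j j)) (parity-twice+1 j)

⌊twice+1/2⌋ : ∀ j → ⌊ suc (j + j) /2⌋ ≡ j
⌊twice+1/2⌋ zero    = refl
⌊twice+1/2⌋ (suc j) = cong suc (trans (cong ⌊_/2⌋ (+-suc j j)) (⌊twice+1/2⌋ j))

module Modulo (M : ℕ) where

  infixl 6 _⊕_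
  _⊕_ : ℕ → ℕ → ℕ
  x ⊕ y = (x + y) % suc M

  -- adding suc M first keeps the truncated subtraction exact for x ≤ suc M
  infixl 6 _⊖_
  _⊖_ : ℕ → ℕ → ℕ
  y ⊖ x = (suc M + y ∸ x) % suc M

  ⊖-< : ∀ y x → y ⊖ x < suc M
  ⊖-< y x = m%n<n (suc M + y ∸ x) (suc M)

  ⊕-no-wrap : ∀ x y → x + y < suc M → x ⊕ y ≡ x + y
  ⊕-no-wrap x y = m<n⇒m%n≡m

  ⊕-wrap : ∀ x y {z} → z < suc M → x + y ≡ z + suc M → x ⊕ y ≡ z
  ⊕-wrap x y {z} z<m x+y≡z+m = begin
    (x + y) % suc M      ≡⟨ cong (_% suc M) x+y≡z+m ⟩
    (z + suc M) % suc M  ≡⟨ [m+n]%n≡m%n z (suc M) ⟩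
    z % suc M            ≡⟨ m<n⇒m%n≡m z<m ⟩
    z                    ∎
    where open ≡-Reasoning

  ⊕-%ʳ : ∀ x y → x ⊕ y % suc M ≡ x ⊕ y
  ⊕-%ʳ x y = begin
    (x + y % suc M) % suc M                  ≡⟨ %-distribˡ-+ x (y % suc M) (suc M) ⟩
    (x % suc M + y % suc M % suc M) % suc M
      ≡⟨ cong (λ t → (x % suc M + t) % suc M) (m%n%n≡m%n y (suc M)) ⟩
    (x % suc M + y % suc M) % suc M          ≡⟨ %-distribˡ-+ x y (suc M) ⟨
    (x + y) % suc M                          ∎
    where open ≡-Reasoning

  x⊕[y⊖x]≡y : ∀ {x y} → x < suc M → y < suc M → x ⊕ (y ⊖ x) ≡ y
  x⊕[y⊖x]≡y {x} {y} x<m y<m = begin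
    x ⊕ (y ⊖ x)                  ≡⟨ ⊕-%ʳ x (suc M + y ∸ x) ⟩
    x ⊕ (suc M + y ∸ x)          ≡⟨ ⊕-wrap x (suc M + y ∸ x) y<m wraps ⟩
    y                            ∎
    where
    open ≡-Reasoning
    wraps : x + (suc M + y ∸ x) ≡ y + suc M
    wraps = trans (m+[n∸m]≡n (≤-trans (<⇒≤ x<m) (m≤m+n (suc M) y))) (+-comm (suc M) y)

  [x⊕c]⊖x≡c : ∀ {x c} → x < suc M → c < suc M → (x ⊕ c) ⊖ x ≡ c
  [x⊕c]⊖x≡c {x} {c} x<m c<m = begin
    (suc M + (x ⊕ c) ∸ x) % suc M    ≡⟨ cong (λ t → (t ∸ x) % suc M) (+-comm (suc M) (x ⊕ c)) ⟩
    ((x ⊕ c) + suc M ∸ x) % suc M    ≡⟨ cong (_% suc M) (+-∸-assoc (x ⊕ c) (<⇒≤ x<m)) ⟩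
    ((x ⊕ c) + (suc M ∸ x)) % suc M  ≡⟨ cong (_% suc M) (+-comm (x ⊕ c) (suc M ∸ x)) ⟩
    (suc M ∸ x) ⊕ (x + c) % suc M    ≡⟨ ⊕-%ʳ (suc M ∸ x) (x + c) ⟩
    (suc M ∸ x) ⊕ (x + c)            ≡⟨ ⊕-wrap (suc M ∸ x) (x + c) c<m wraps ⟩
    c                                ∎
    where
    open ≡-Reasoning
    wraps : suc M ∸ x + (x + c) ≡ c + suc M
    wraps = trans (sym (+-assoc (suc M ∸ x) x c))
                  (trans (cong (_+ c) (m∸n+n≡m (<⇒≤ x<m))) (+-comm (suc M) c))

  %-*-%ˡ : ∀ x c → (x % suc M * c) % suc M ≡ (x * c) % suc M
  %-*-%ˡ x c = begin
    (x % suc M * c) % suc M                    ≡⟨ %-distribˡ-* (x % suc M) c (suc M) ⟩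
    (x % suc M % suc M * (c % suc M)) % suc M
      ≡⟨ cong (λ t → (t * (c % suc M)) % suc M) (m%n%n≡m%n x (suc M)) ⟩
    (x % suc M * (c % suc M)) % suc M          ≡⟨ %-distribˡ-* x c (suc M) ⟨
    (x * c) % suc M                            ∎
    where open ≡-Reasoning

  x⊖x≡0 : ∀ x → x ⊖ x ≡ 0
  x⊖x≡0 x = trans (cong (_% suc M) (m+n∸n≡m (suc M) x)) (n%n≡0 (suc M))

module CycleLabelling {h M : ℕ} (M≡ : M ≡ suc (h + h)) where

  open Modulo M

  labelByParity : Parity → ℕ → ℕ
  labelByParity 0ℙ j = j
  labelByParity 1ℙ j = M ∸ j

  cycleLabel : ℕ → ℕ
  cycleLabel p = labelByParity (parity p) ⌊ p /2⌋

  cycleLabel-twice : ∀ j → cycleLabel (j + j) ≡ j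
  cycleLabel-twice j = cong₂ labelByParity (parity-twice j) (sym (n≡⌊n+n/2⌋ j))

  cycleLabel-twice+1 : ∀ j → cycleLabel (suc (j + j)) ≡ M ∸ j
  cycleLabel-twice+1 j = cong₂ labelByParity (parity-twice+1 j) (⌊twice+1/2⌋ j)

  ⌊/2⌋≤h : ∀ {p} → p ≤ M → ⌊ p /2⌋ ≤ h
  ⌊/2⌋≤h {p} p≤M = subst (⌊ p /2⌋ ≤_) (⌊twice+1/2⌋ h) (⌊n/2⌋-mono (subst (p ≤_) M≡ p≤M))

  twice≤M⇒≤h : ∀ {j} → j + j ≤ M → j ≤ h
  twice≤M⇒≤h {j} jj≤M = subst (_≤ h) (sym (n≡⌊n+n/2⌋ j)) (⌊/2⌋≤h jj≤M)

  twice+1≤M⇒≤h : ∀ {j} → suc (j + j) ≤ M → j ≤ h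
  twice+1≤M⇒≤h {j} jj≤M = subst (_≤ h) (⌊twice+1/2⌋ j) (⌊/2⌋≤h jj≤M)

  twice+1≤M : ∀ {j} → j ≤ h → suc (j + j) ≤ M
  twice+1≤M {j} j≤h = subst (suc (j + j) ≤_) (sym M≡) (s≤s (+-mono-≤ j≤h j≤h))

  h<M : h < M
  h<M = ≤-trans (s≤s (m≤m+n h h)) (twice+1≤M ≤-refl)

  M∸-≤h : ∀ {y} → h < y → M ∸ y ≤ h
  M∸-≤h {y} h<y = ≤-trans (∸-monoʳ-≤ M h<y) (≤-reflexive M∸[1+h]≡h)
    where
    M∸[1+h]≡h : M ∸ suc h ≡ h
    M∸[1+h]≡h = trans (cong (_∸ suc h) M≡) (m+n∸n≡m h h)

  h<M∸ : ∀ {j} → j ≤ h → h < M ∸ j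
  h<M∸ {j} j≤h = ≤-trans (≤-reflexive (sym M∸h≡1+h)) (∸-monoʳ-≤ M j≤h)
    where
    M∸h≡1+h : M ∸ h ≡ suc h
    M∸h≡1+h = trans (cong (_∸ h) M≡) (m+n∸n≡m (suc h) h)

  cycleLabel-< : ∀ {p} → p < suc M → cycleLabel p < suc M
  cycleLabel-< {p} p<m with half p
  ... | twice j   = subst (_< suc M) (sym (cycleLabel-twice j)) (≤-<-trans (m≤m+n j j) p<m)
  ... | twice+1 j = subst (_< suc M) (sym (cycleLabel-twice+1 j)) (s≤s (m∸n≤m M j))

  cycleLabel⁻¹ : ℕ → ℕ
  cycleLabel⁻¹ y = if does (y ≤? h) then y + y else suc ((M ∸ y) + (M ∸ y))

  cycleLabel⁻¹-≤ : ∀ {y} → y ≤ h → cycleLabel⁻¹ y ≡ y + y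
  cycleLabel⁻¹-≤ {y} y≤h = cong (if_then y + y else _) (dec-true (y ≤? h) y≤h)

  cycleLabel⁻¹-> : ∀ {y} → h < y → cycleLabel⁻¹ y ≡ suc ((M ∸ y) + (M ∸ y))
  cycleLabel⁻¹-> {y} h<y = cong (if_then y + y else _) (dec-false (y ≤? h) (<⇒≱ h<y))

  cycleLabel⁻¹-< : ∀ {y} → y < suc M → cycleLabel⁻¹ y < suc M
  cycleLabel⁻¹-< {y} y<m with y ≤? h
  ... | yes y≤h = subst (_< suc M) (sym (cycleLabel⁻¹-≤ y≤h))
                        (s≤s (≤-trans (n≤1+n _) (twice+1≤M y≤h)))
  ... | no  y≰h = subst (_< suc M) (sym (cycleLabel⁻¹-> (≰⇒> y≰h)))
                        (s≤s (twice+1≤M (M∸-≤h (≰⇒> y≰h))))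

  cycleLabel⁻¹∘cycleLabel : ∀ {p} → p < suc M → cycleLabel⁻¹ (cycleLabel p) ≡ p
  cycleLabel⁻¹∘cycleLabel {p} p<m with half p
  ... | twice j = begin
    cycleLabel⁻¹ (cycleLabel (j + j)) ≡⟨ cong cycleLabel⁻¹ (cycleLabel-twice j) ⟩
    cycleLabel⁻¹ j                    ≡⟨ cycleLabel⁻¹-≤ {j} (twice≤M⇒≤h (s≤s⁻¹ p<m)) ⟩
    j + j                             ∎
    where open ≡-Reasoning
  ... | twice+1 j = begin
    cycleLabel⁻¹ (cycleLabel (suc (j + j))) ≡⟨ cong cycleLabel⁻¹ (cycleLabel-twice+1 j) ⟩
    cycleLabel⁻¹ (M ∸ j)                    ≡⟨ cycleLabel⁻¹-> (h<M∸ j≤h) ⟩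
    suc (M ∸ (M ∸ j) + (M ∸ (M ∸ j)))
      ≡⟨ cong (λ k → suc (k + k)) (m∸[m∸n]≡n (≤-trans j≤h (<⇒≤ h<M))) ⟩
    suc (j + j)                             ∎
    where
    open ≡-Reasoning
    j≤h : j ≤ h
    j≤h = twice+1≤M⇒≤h (s≤s⁻¹ p<m)

  cycleLabel∘cycleLabel⁻¹ : ∀ {y} → y < suc M → cycleLabel (cycleLabel⁻¹ y) ≡ y
  cycleLabel∘cycleLabel⁻¹ {y} y<m with y ≤? h
  ... | yes y≤h = trans (cong cycleLabel (cycleLabel⁻¹-≤ y≤h)) (cycleLabel-twice y)
  ... | no  y≰h = begin
    cycleLabel (cycleLabel⁻¹ y)            ≡⟨ cong cycleLabel (cycleLabel⁻¹-> (≰⇒> y≰h)) ⟩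
    cycleLabel (suc ((M ∸ y) + (M ∸ y)))   ≡⟨ cycleLabel-twice+1 (M ∸ y) ⟩
    M ∸ (M ∸ y)                            ≡⟨ m∸[m∸n]≡n (s≤s⁻¹ y<m) ⟩
    y                                      ∎
    where open ≡-Reasoning

  cycleLabel-bijective : BijectiveBelow (suc M) cycleLabel
  cycleLabel-bijective = record
    { inverse   = cycleLabel⁻¹
    ; φ-<       = cycleLabel-<
    ; inverse-< = cycleLabel⁻¹-<
    ; inverse∘φ = cycleLabel⁻¹∘cycleLabel
    ; φ∘inverse = cycleLabel∘cycleLabel⁻¹
    }

  -- p ⊕ M is the predecessor of p on the cycle
  closedSum : ℕ → ℕ
  closedSum p = cycleLabel p + cycleLabel (p ⊕ 1) + cycleLabel (p ⊕ M)

  suc-⊕M : ∀ {q} → q < suc M → suc q ⊕ M ≡ q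
  suc-⊕M {q} q<m = ⊕-wrap (suc q) M q<m (sym (+-suc q M))

  cycleLabel-M : cycleLabel M ≡ M ∸ h
  cycleLabel-M = trans (cong cycleLabel M≡) (cycleLabel-twice+1 h)

  ⊕1-no-wrap : ∀ p → suc p ≤ M → p ⊕ 1 ≡ suc p
  ⊕1-no-wrap p p<M = trans (⊕-no-wrap p 1 (s≤s (subst (_≤ M) (+-comm 1 p) p<M))) (+-comm p 1)

  closedSum-zero : closedSum 0 + h ≡ M + M
  closedSum-zero = begin
    0 + cycleLabel (0 ⊕ 1) + cycleLabel (0 ⊕ M) + h
      ≡⟨ cong₂ (λ a b → cycleLabel a + cycleLabel b + h)
               (⊕1-no-wrap 0 (≤-trans (s≤s z≤n) h<M)) (⊕-no-wrap 0 M (n<1+n M)) ⟩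
    M + cycleLabel M + h   ≡⟨ cong (λ a → M + a + h) cycleLabel-M ⟩
    M + (M ∸ h) + h        ≡⟨ +-assoc M (M ∸ h) h ⟩
    M + (M ∸ h + h)        ≡⟨ cong (M +_) (m∸n+n≡m (<⇒≤ h<M)) ⟩
    M + M                  ∎
    where open ≡-Reasoning

  closedSum-twice : ∀ {j} → j < h → closedSum (suc j + suc j) + j ≡ M + M
  closedSum-twice {j} j<h = begin
    cycleLabel (suc j + suc j) + cycleLabel ((suc j + suc j) ⊕ 1) + cycleLabel ((suc j + suc j) ⊕ M) + j
      ≡⟨ cong₂ (λ b c → cycleLabel (suc j + suc j) + cycleLabel b + cycleLabel c + j) next prev ⟩
    cycleLabel (suc j + suc j) + cycleLabel (suc (suc j + suc j)) + cycleLabel (suc (j + j)) + j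
      ≡⟨ cong₂ (λ a b → a + b + cycleLabel (suc (j + j)) + j)
               (cycleLabel-twice (suc j)) (cycleLabel-twice+1 (suc j)) ⟩
    suc j + (M ∸ suc j) + cycleLabel (suc (j + j)) + j
      ≡⟨ cong (λ c → suc j + (M ∸ suc j) + c + j) (cycleLabel-twice+1 j) ⟩
    suc j + (M ∸ suc j) + (M ∸ j) + j
      ≡⟨ shuffle (suc j) (M ∸ suc j) (M ∸ j) j ⟩
    (M ∸ suc j + suc j) + (M ∸ j + j)
      ≡⟨ cong₂ _+_ (m∸n+n≡m sj≤M) (m∸n+n≡m (≤-trans (n≤1+n j) sj≤M)) ⟩
    M + M ∎
    where
    open ≡-Reasoning
    shuffle : ∀ a b c d → a + b + c + d ≡ (b + a) + (c + d)
    shuffle = solve-∀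
    sj≤M : suc j ≤ M
    sj≤M = <⇒≤ (≤-<-trans j<h h<M)
    next : (suc j + suc j) ⊕ 1 ≡ suc (suc j + suc j)
    next = ⊕1-no-wrap (suc j + suc j) (twice+1≤M j<h)
    prev : (suc j + suc j) ⊕ M ≡ suc (j + j)
    prev = trans (suc-⊕M (s≤s (<⇒≤ (<⇒≤ (twice+1≤M j<h))))) (+-suc j j)

  closedSum-twice+1 : ∀ {j x} → j < h → suc j + x ≡ M → closedSum (suc (j + j)) + x ≡ M + M
  closedSum-twice+1 {j} {x} j<h sj+x≡M = begin
    cycleLabel (suc (j + j)) + cycleLabel (suc (j + j) ⊕ 1) + cycleLabel (suc (j + j) ⊕ M) + x
      ≡⟨ cong₂ (λ b c → cycleLabel (suc (j + j)) + cycleLabel b + cycleLabel c + x) next prev ⟩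
    cycleLabel (suc (j + j)) + cycleLabel (suc j + suc j) + cycleLabel (j + j) + x
      ≡⟨ cong₂ (λ a b → a + b + cycleLabel (j + j) + x) (cycleLabel-twice+1 j) (cycleLabel-twice (suc j)) ⟩
    (M ∸ j) + suc j + cycleLabel (j + j) + x
      ≡⟨ cong (λ c → (M ∸ j) + suc j + c + x) (cycleLabel-twice j) ⟩
    (M ∸ j) + suc j + j + x
      ≡⟨ shuffle (M ∸ j) j x ⟩
    (M ∸ j + j) + (suc j + x)
      ≡⟨ cong₂ _+_ (m∸n+n≡m (≤-trans (n≤1+n j) (≤-trans j<h (<⇒≤ h<M)))) sj+x≡M ⟩
    M + M ∎
    where
    open ≡-Reasoning
    shuffle : ∀ a j x → a + suc j + j + x ≡ (a + j) + (suc j + x)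
    shuffle = solve-∀
    next : suc (j + j) ⊕ 1 ≡ suc j + suc j
    next = trans (⊕1-no-wrap (suc (j + j)) (subst (λ k → suc k ≤ M) (+-suc j j) (<⇒≤ (twice+1≤M j<h))))
                 (cong suc (sym (+-suc j j)))
    prev : suc (j + j) ⊕ M ≡ j + j
    prev = suc-⊕M (s≤s (≤-trans (n≤1+n _) (twice+1≤M (<⇒≤ j<h))))

  closedSum-M : closedSum M + M ≡ M + M
  closedSum-M = cong (_+ M) (begin
    cycleLabel M + cycleLabel (M ⊕ 1) + cycleLabel (M ⊕ M)
      ≡⟨ cong₂ (λ b c → cycleLabel M + cycleLabel b + cycleLabel c)
               (⊕-wrap M 1 (s≤s z≤n) (+-comm M 1)) (trans (cong (_⊕ M) M≡) (suc-⊕M hh<m)) ⟩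
    cycleLabel M + 0 + cycleLabel (h + h)
      ≡⟨ cong₂ (λ a c → a + 0 + c) cycleLabel-M (cycleLabel-twice h) ⟩
    M ∸ h + 0 + h
      ≡⟨ cong (_+ h) (+-identityʳ (M ∸ h)) ⟩
    M ∸ h + h
      ≡⟨ m∸n+n≡m (<⇒≤ h<M) ⟩
    M ∎)
    where
    open ≡-Reasoning
    hh<m : h + h < suc M
    hh<m = s≤s (≤-trans (n≤1+n _) (≤-reflexive (sym M≡)))

  closedSum-offset : ∀ {p} → p < suc M → ∃[ x ] x < suc M × closedSum p + x ≡ M + M
  closedSum-offset {p} p<m with half p
  ... | twice zero    = h , <-trans h<M (n<1+n M) , closedSum-zero
  ... | twice (suc j) = j , <-trans (<-trans j<h h<M) (n<1+n M) , closedSum-twice j<h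
    where
    j<h : j < h
    j<h = twice≤M⇒≤h (s≤s⁻¹ p<m)
  ... | twice+1 j with j <? h
  ...   | yes j<h = M ∸ suc j , s≤s (m∸n≤m M (suc j)) , closedSum-twice+1 j<h (m+[n∸m]≡n (<-trans j<h h<M))
  ...   | no  j≮h = M , n<1+n M , subst (λ q → closedSum q + M ≡ M + M) M≡[j] closedSum-M
    where
    M≡[j] : M ≡ suc (j + j)
    M≡[j] = trans M≡ (cong (λ k → suc (k + k)) (≤-antisym (≮⇒≥ j≮h) (twice+1≤M⇒≤h (s≤s⁻¹ p<m))))

  offset-closedSum : ∀ {x} → x < suc M → ∃[ p ] p < suc M × closedSum p + x ≡ M + M
  offset-closedSum {x} x<m with <-cmp x h
  ... | tri< x<h _ _ = suc x + suc x , s≤s (<⇒≤ (twice+1≤M x<h)) , closedSum-twice x<h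
  ... | tri≈ _ refl _ = 0 , s≤s z≤n , closedSum-zero
  ... | tri> _ _ h<x with x ≟ M
  ...   | yes refl = M , n<1+n M , closedSum-M
  ...   | no  x≢M = suc (j + j) , s≤s (twice+1≤M (<⇒≤ j<h)) , closedSum-twice+1 j<h sj+x≡M
    where
    j : ℕ
    j = M ∸ suc x
    sj+x≡M : suc j + x ≡ M
    sj+x≡M = trans (sym (+-suc j x)) (m∸n+n≡m (≤∧≢⇒< (s≤s⁻¹ x<m) x≢M))
    j<h : j < h
    j<h = +-cancelʳ-< x j h (subst (_< h + x) (sym (suc-injective (trans sj+x≡M M≡))) (+-monoʳ-< h h<x))

module Position (n : ℕ) where

  private
    M : ℕ
    M = 4 * n + 3

  open Modulo M

  position : ℕ → ℕ
  position x = (x * (2 * n + 1)) % suc M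

  position-< : ∀ x → position x < suc M
  position-< x = m%n<n (x * (2 * n + 1)) (suc M)

  position-⊕ : ∀ x t → position (x ⊕ t) ≡ position x ⊕ position t
  position-⊕ x t = begin
    ((x + t) % suc M * (2 * n + 1)) % suc M      ≡⟨ %-*-%ˡ (x + t) (2 * n + 1) ⟩
    ((x + t) * (2 * n + 1)) % suc M              ≡⟨ cong (_% suc M) (*-distribʳ-+ (2 * n + 1) x t) ⟩
    (x * (2 * n + 1) + t * (2 * n + 1)) % suc M  ≡⟨ %-distribˡ-+ (x * (2 * n + 1)) (t * (2 * n + 1)) (suc M) ⟩
    position x ⊕ position t                      ∎
    where open ≡-Reasoning

  position-involutive : ∀ {x} → x < suc M → position (position x) ≡ x
  position-involutive {x} x<m = begin
    position (position x)                    ≡⟨ %-*-%ˡ (x * (2 * n + 1)) (2 * n + 1) ⟩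
    (x * (2 * n + 1) * (2 * n + 1)) % suc M  ≡⟨ cong (_% suc M) (square x n) ⟩
    (x + x * n * suc M) % suc M              ≡⟨ [m+kn]%n≡m%n x (x * n) (suc M) ⟩
    x % suc M                                ≡⟨ m<n⇒m%n≡m x<m ⟩
    x                                        ∎
    where
    open ≡-Reasoning
    square : ∀ x n → x * (2 * n + 1) * (2 * n + 1) ≡ x + x * n * suc (4 * n + 3)
    square = solve-∀

  position-2n+1 : position (2 * n + 1) ≡ 1
  position-2n+1 = begin
    ((2 * n + 1) * (2 * n + 1)) % suc M  ≡⟨ cong (_% suc M) (square n) ⟩
    (1 + n * suc M) % suc M              ≡⟨ [m+kn]%n≡m%n 1 n (suc M) ⟩
    1 % suc M                            ≡⟨ m<n⇒m%n≡m (s≤s (≤-trans (s≤s z≤n) (m≤n+m 3 (4 * n)))) ⟩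
    1                                    ∎
    where
    open ≡-Reasoning
    square : ∀ n → (2 * n + 1) * (2 * n + 1) ≡ 1 + n * suc (4 * n + 3)
    square = solve-∀

  position-2n+3 : position (2 * n + 3) ≡ M
  position-2n+3 = begin
    ((2 * n + 3) * (2 * n + 1)) % suc M  ≡⟨ cong (_% suc M) (product n) ⟩
    (M + n * suc M) % suc M              ≡⟨ [m+kn]%n≡m%n M n (suc M) ⟩
    M % suc M                            ≡⟨ m<n⇒m%n≡m (n<1+n M) ⟩
    M                                    ∎
    where
    open ≡-Reasoning
    product : ∀ n → (2 * n + 3) * (2 * n + 1) ≡ 4 * n + 3 + n * suc (4 * n + 3)
    product = solve-∀

module Circulant (n : ℕ) where

  private
    m M : ℕ
    m = 4 * n + 4
    M = 4 * n + 3

  open Modulo M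

  ConnectionSet : ℕ → Set
  ConnectionSet δ = (1 ≤ δ × δ ≤ 2 * n) ⊎ (m ∸ 2 * n ≤ δ × δ ≤ m ∸ 1) ⊎ δ ≡ 2 * n + 2

  connectionSet? : ∀ δ → Dec (ConnectionSet δ)
  connectionSet? δ =
    (1 ≤? δ ×-dec δ ≤? 2 * n) ⊎-dec ((m ∸ 2 * n ≤? δ) ×-dec (δ ≤? m ∸ 1)) ⊎-dec (δ ≟ 2 * n + 2)

  m≡suc : m ≡ suc M
  m≡suc = +-suc (4 * n) 3

  H-circulant : ∀ i j → H n i j ≡ not (toℕ i ≡ᵇ toℕ j) ∧ does (connectionSet? (toℕ j ⊖ toℕ i))
  H-circulant i j =
    cong (λ k → not (toℕ i ≡ᵇ toℕ j) ∧ does (connectionSet? ((k + toℕ j ∸ toℕ i) % suc M))) m≡suc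

  NonStep : ℕ → Set
  NonStep δ = δ ≡ 0 ⊎ δ ≡ 2 * n + 1 ⊎ δ ≡ 2 * n + 3

  lower-end : m ∸ 2 * n ≡ 2 * n + 4
  lower-end = trans (cong (_∸ 2 * n) (halves n)) (m+n∸m≡n (2 * n) (2 * n + 4))
    where
    halves : ∀ n → 4 * n + 4 ≡ 2 * n + (2 * n + 4)
    halves = solve-∀

  upper-end : m ∸ 1 ≡ M
  upper-end = cong (_∸ 1) m≡suc

  nonStep⇒∉connectionSet : ∀ {δ} → NonStep δ → ¬ ConnectionSet δ
  nonStep⇒∉connectionSet (inj₁ refl) (inj₁ (() , _))
  nonStep⇒∉connectionSet (inj₁ refl) (inj₂ (inj₁ (lo , _)))
    with () ← ≤-trans (m≤n+m 4 (2 * n)) (subst (_≤ 0) lower-end lo)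
  nonStep⇒∉connectionSet (inj₁ refl) (inj₂ (inj₂ 0≡)) with () ← trans 0≡ (+-suc (2 * n) 1)
  nonStep⇒∉connectionSet (inj₂ (inj₁ refl)) (inj₁ (_ , hi)) = m+1+n≰m (2 * n) hi
  nonStep⇒∉connectionSet (inj₂ (inj₁ refl)) (inj₂ (inj₁ (lo , _)))
    with s≤s () ← +-cancelˡ-≤ (2 * n) 4 1 (subst (_≤ 2 * n + 1) lower-end lo)
  nonStep⇒∉connectionSet (inj₂ (inj₁ refl)) (inj₂ (inj₂ eq)) with () ← +-cancelˡ-≡ (2 * n) 1 2 eq
  nonStep⇒∉connectionSet (inj₂ (inj₂ refl)) (inj₁ (_ , hi)) = m+1+n≰m (2 * n) hi
  nonStep⇒∉connectionSet (inj₂ (inj₂ refl)) (inj₂ (inj₁ (lo , _)))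
    with s≤s (s≤s (s≤s ())) ← +-cancelˡ-≤ (2 * n) 4 3 (subst (_≤ 2 * n + 3) lower-end lo)
  nonStep⇒∉connectionSet (inj₂ (inj₂ refl)) (inj₂ (inj₂ eq)) with () ← +-cancelˡ-≡ (2 * n) 3 2 eq

  ∉connectionSet⇒nonStep : ∀ {δ} → δ < suc M → ¬ ConnectionSet δ → NonStep δ
  ∉connectionSet⇒nonStep {δ} δ<m δ∉ with δ ≟ 0 | δ ≟ 2 * n + 1 | δ ≟ 2 * n + 3
  ... | yes δ≡0 | _       | _       = inj₁ δ≡0
  ... | no _    | yes δ≡  | _       = inj₂ (inj₁ δ≡)
  ... | no _    | no _    | yes δ≡  = inj₂ (inj₂ δ≡)
  ... | no δ≢0  | no δ≢s1 | no δ≢s3 = contradiction member δ∉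
    where
    next : ∀ k → 2 * n + k ≤ δ → δ ≢ 2 * n + k → 2 * n + suc k ≤ δ
    next k le ne = subst (_≤ δ) (sym (+-suc (2 * n) k)) (≤∧≢⇒< le (ne ∘ sym))

    member : ConnectionSet δ
    member with δ ≤? 2 * n
    ... | yes δ≤s = inj₁ (n≢0⇒n>0 δ≢0 , δ≤s)
    ... | no  δ≰s with δ ≟ 2 * n + 2
    ...   | yes δ≡  = inj₂ (inj₂ δ≡)
    ...   | no δ≢s2 =
      inj₂ (inj₁ (subst (_≤ δ) (sym lower-end) s4≤δ , subst (δ ≤_) (sym upper-end) (s≤s⁻¹ δ<m)))
      where
      s4≤δ : 2 * n + 4 ≤ δ
      s4≤δ = next 3 (next 2 (next 1 (subst (_≤ δ) (+-comm 1 (2 * n)) (≰⇒> δ≰s)) δ≢s1) δ≢s2) δ≢s3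

  H≡false⇔nonStep : ∀ u v → H n u v ≡ false ⇔ NonStep (toℕ v ⊖ toℕ u)
  H≡false⇔nonStep u v = mk⇔ to from
    where
    x = toℕ u
    y = toℕ v
    to : H n u v ≡ false → NonStep (y ⊖ x)
    to H≡false with x ≟ y | connectionSet? (y ⊖ x) in connected
    ... | yes x≡y | _      = inj₁ (trans (cong (_⊖ x) (sym x≡y)) (x⊖x≡0 x))
    ... | no _    | no  ∉S = ∉connectionSet⇒nonStep (⊖-< y x) ∉S
    ... | no x≢y  | yes ∈S with () ← trans (sym H≡false) (trans (H-circulant u v)
                                      (cong₂ (λ a b → not a ∧ b) (dec-false (x ≟ y) x≢y) (cong does connected)))
    from : NonStep (y ⊖ x) → H n u v ≡ false
    from nonStep = trans (H-circulant u v) (trans (cong (not (x ≡ᵇ y) ∧_) not-connected) (∧-zeroʳ _))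
      where
      not-connected : does (connectionSet? (y ⊖ x)) ≡ false
      not-connected = dec-false (connectionSet? (y ⊖ x)) (nonStep⇒∉connectionSet nonStep)

  toℕ<m : (u : Fin m) → toℕ u < suc M
  toℕ<m u = subst (toℕ u <_) m≡suc (toℕ<n u)

  fromℕ<m : ∀ {x} → x < suc M → Fin m
  fromℕ<m {x} x<m = fromℕ< (subst (x <_) (sym m≡suc) x<m)

  toℕ-fromℕ<m : ∀ {x} (x<m : x < suc M) → toℕ (fromℕ<m x<m) ≡ x
  toℕ-fromℕ<m x<m = toℕ-fromℕ< _

  shift : Fin m → ℕ → Fin m
  shift u c = fromℕ<m (m%n<n (toℕ u + c) (suc M))

  toℕ-shift : ∀ u c → toℕ (shift u c) ≡ toℕ u ⊕ c
  toℕ-shift u c = toℕ-fromℕ<m (m%n<n (toℕ u + c) (suc M))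

  ⊖≡⇔≡shift : ∀ u v {c} → c < suc M → toℕ v ⊖ toℕ u ≡ c ⇔ v ≡ shift u c
  ⊖≡⇔≡shift u v {c} c<m = mk⇔ to from
    where
    to : toℕ v ⊖ toℕ u ≡ c → v ≡ shift u c
    to v⊖u≡c = toℕ-injective (begin
      toℕ v                    ≡⟨ x⊕[y⊖x]≡y (toℕ<m u) (toℕ<m v) ⟨
      toℕ u ⊕ (toℕ v ⊖ toℕ u)  ≡⟨ cong (toℕ u ⊕_) v⊖u≡c ⟩
      toℕ u ⊕ c                ≡⟨ toℕ-shift u c ⟨
      toℕ (shift u c)          ∎)
      where open ≡-Reasoning
    from : v ≡ shift u c → toℕ v ⊖ toℕ u ≡ c
    from refl = trans (cong (_⊖ toℕ u) (toℕ-shift u c)) ([x⊕c]⊖x≡c (toℕ<m u) c<m)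

  shift-zero : ∀ u → shift u 0 ≡ u
  shift-zero u = sym (Equivalence.to (⊖≡⇔≡shift u u (s≤s z≤n)) (x⊖x≡0 (toℕ u)))

  shift-injective : ∀ u {c d} → c < suc M → d < suc M → shift u c ≡ shift u d → c ≡ d
  shift-injective u c<m d<m eq =
    trans (sym (Equivalence.from (⊖≡⇔≡shift u _ c<m) refl)) (Equivalence.from (⊖≡⇔≡shift u _ d<m) eq)

  2n+3<m : 2 * n + 3 < suc M
  2n+3<m = s≤s (+-monoˡ-≤ 3 (*-monoˡ-≤ n (s≤s (s≤s (z≤n {2})))))

  2n+1<m : 2 * n + 1 < suc M
  2n+1<m = ≤-<-trans (+-monoʳ-≤ (2 * n) (s≤s (z≤n {2}))) 2n+3<m

  nonNeighbour⇔ : ∀ u v →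
                  H n u v ≡ false ⇔ (v ≡ u ⊎ v ≡ shift u (2 * n + 1) ⊎ v ≡ shift u (2 * n + 3))
  nonNeighbour⇔ u v =
    (subst (λ w → toℕ v ⊖ toℕ u ≡ 0 ⇔ v ≡ w) (shift-zero u) (⊖≡⇔≡shift u v (s≤s z≤n))
      ⊎-⇔ ⊖≡⇔≡shift u v 2n+1<m
      ⊎-⇔ ⊖≡⇔≡shift u v 2n+3<m)
    ⇔-∘ H≡false⇔nonStep u v

4n+3≡2[2n+1]+1 : ∀ n → 4 * n + 3 ≡ suc ((2 * n + 1) + (2 * n + 1))
4n+3≡2[2n+1]+1 = solve-∀

module Labelling (n : ℕ) where

  private
    m M : ℕ
    m = 4 * n + 4
    M = 4 * n + 3

  open Modulo M
  open Position n
  open Circulant n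
  open CycleLabelling {h = 2 * n + 1} (4n+3≡2[2n+1]+1 n)

  labelling-bijectiveBelow : BijectiveBelow (suc m) (extendTop m (cycleLabel ∘ position))
  labelling-bijectiveBelow = bijectiveBelow-extendTop
    (subst (λ N → BijectiveBelow N (cycleLabel ∘ position)) (sym m≡suc)
      (bijectiveBelow-∘ cycleLabel-bijective
        (involution⇒bijectiveBelow (λ {x} _ → position-< x) position-involutive)))

  labelling : Permutation′ (suc m)
  labelling = toPermutation labelling-bijectiveBelow

  f : Fin (suc m) → Fin (suc m)
  f = labelling ⟨$⟩ʳ_

  bijective : Bijective _≡_ _≡_ f
  bijective = Bijection.bijective (Inverse⇒Bijection labelling)

  label-apex : label f zero ≡ suc m
  label-apex = cong suc (toℕ-toPermutation labelling-bijectiveBelow zero)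

  vertexLabel : Fin m → ℕ
  vertexLabel v = label f (suc v)

  vertexLabel≡ : ∀ v → vertexLabel v ≡ suc (cycleLabel (position (toℕ v)))
  vertexLabel≡ v = cong suc (toℕ-toPermutation labelling-bijectiveBelow (suc v))

  vertexLabel-shift : ∀ u c → vertexLabel (shift u c) ≡ suc (cycleLabel (position (toℕ u) ⊕ position c))
  vertexLabel-shift u c = trans (vertexLabel≡ (shift u c))
    (cong (suc ∘ cycleLabel) (trans (cong position (toℕ-shift u c)) (position-⊕ (toℕ u) c)))

  a : ℕ
  a = 8 * n * n + 14 * n + 6

  G : Graph (suc m)
  G = join-K1 (H n)

  ∑-vertexLabel : ∑[ v < m ] vertexLabel v ≡ a + m
  ∑-vertexLabel = +-cancelˡ-≡ (suc m) _ _ (*-cancelˡ-≡ _ _ 2 (begin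
    2 * (suc m + ∑[ v < m ] vertexLabel v)  ≡⟨ cong (λ l → 2 * (l + ∑[ v < m ] vertexLabel v)) label-apex ⟨
    2 * ∑[ v < suc m ] label f v            ≡⟨ cong (2 *_) (sum-permute (suc ∘ toℕ) labelling) ⟨
    2 * ∑[ v < suc m ] suc (toℕ v)          ≡⟨ ∑-suc-toℕ (suc m) ⟩
    suc m * suc (suc m)                     ≡⟨ gauss n ⟩
    2 * (suc m + (a + m))                   ∎))
    where
    open ≡-Reasoning
    gauss : ∀ n → suc (4 * n + 4) * suc (suc (4 * n + 4)) ≡
                  2 * (suc (4 * n + 4) + (8 * n * n + 14 * n + 6 + (4 * n + 4)))
    gauss = solve-∀

  ∑-nonNeighbours : ∀ u →
                    ∑[ v < m ] (if H n u v then 0 else vertexLabel v) ≡ closedSum (position (toℕ u)) + 3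
  ∑-nonNeighbours u = begin
    ∑[ v < m ] (if H n u v then 0 else vertexLabel v)
      ≡⟨ ∑-outside-three (H n u) vertexLabel u≢u₁ u≢u₂ u₁≢u₂ (nonNeighbour⇔ u) ⟩
    vertexLabel u + vertexLabel (shift u (2 * n + 1)) + vertexLabel (shift u (2 * n + 3))
      ≡⟨ cong₂ _+_ (cong₂ _+_ (vertexLabel≡ u) (vertexLabel-shift u (2 * n + 1)))
                   (vertexLabel-shift u (2 * n + 3)) ⟩
    suc (ℓ p) + suc (ℓ (p ⊕ position (2 * n + 1))) + suc (ℓ (p ⊕ position (2 * n + 3)))
      ≡⟨ cong₂ (λ s t → suc (ℓ p) + suc (ℓ (p ⊕ s)) + suc (ℓ (p ⊕ t))) position-2n+1 position-2n+3 ⟩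
    suc (ℓ p) + suc (ℓ (p ⊕ 1)) + suc (ℓ (p ⊕ M))
      ≡⟨ three-sucs (ℓ p) (ℓ (p ⊕ 1)) (ℓ (p ⊕ M)) ⟩
    closedSum p + 3 ∎
    where
    open ≡-Reasoning
    p = position (toℕ u)
    ℓ = cycleLabel
    three-sucs : ∀ x y z → suc x + suc y + suc z ≡ x + y + z + 3
    three-sucs = solve-∀
    u≢u₁ : u ≢ shift u (2 * n + 1)
    u≢u₁ eq with () ← trans (shift-injective u (s≤s z≤n) 2n+1<m (trans (shift-zero u) eq)) (+-comm (2 * n) 1)
    u≢u₂ : u ≢ shift u (2 * n + 3)
    u≢u₂ eq with () ← trans (shift-injective u (s≤s z≤n) 2n+3<m (trans (shift-zero u) eq)) (+-comm (2 * n) 3)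
    u₁≢u₂ : shift u (2 * n + 1) ≢ shift u (2 * n + 3)
    u₁≢u₂ eq with () ← +-cancelˡ-≡ (2 * n) 1 3 (shift-injective u 2n+1<m 2n+3<m eq)

  apexWeight : weight G f zero ≡ a + m
  apexWeight = trans (weight-join-apex (H n) f) ∑-vertexLabel

  vertexWeight : ∀ u → weight G f (suc u) + (closedSum (position (toℕ u)) + 3) ≡ suc m + (a + m)
  vertexWeight u = begin
    weight G f (suc u) + (closedSum (position (toℕ u)) + 3)
      ≡⟨ cong₂ _+_ (weight-join-vertex (H n) f u) (sym (∑-nonNeighbours u)) ⟩
    label f zero + ∑[ v < m ] neighbour v + ∑[ v < m ] nonNeighbour v
      ≡⟨ +-assoc (label f zero) _ _ ⟩
    label f zero + (∑[ v < m ] neighbour v + ∑[ v < m ] nonNeighbour v)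
      ≡⟨ cong₂ _+_ label-apex (trans (∑-split (H n u) vertexLabel) ∑-vertexLabel) ⟩
    suc m + (a + m) ∎
    where
    open ≡-Reasoning
    neighbour nonNeighbour : Fin m → ℕ
    neighbour    v = if H n u v then vertexLabel v else 0
    nonNeighbour v = if H n u v then 0 else vertexLabel v

  weight≡a+offset : ∀ {w s x} → w + (s + 3) ≡ suc m + (a + m) → s + x ≡ M + M → w ≡ a + x
  weight≡a+offset {w} {s} {x} w+s+3≡ s+x≡ = +-cancelʳ-≡ (s + 3) w (a + x) (begin
    w + (s + 3)          ≡⟨ w+s+3≡ ⟩
    suc m + (a + m)      ≡⟨ total n a ⟨
    a + (M + M) + 3      ≡⟨ cong (λ t → a + t + 3) s+x≡ ⟨
    a + (s + x) + 3      ≡⟨ regroup a s x ⟩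
    a + x + (s + 3)      ∎)
    where
    open ≡-Reasoning
    total : ∀ n a → a + ((4 * n + 3) + (4 * n + 3)) + 3 ≡ suc (4 * n + 4) + (a + (4 * n + 4))
    total = solve-∀
    regroup : ∀ a s x → a + (s + x) + 3 ≡ a + x + (s + 3)
    regroup = solve-∀

  weight-offset : ∀ u → Σ[ i ∈ Fin (suc m) ] weight G f u ≡ a + toℕ i
  weight-offset zero = fromℕ m , trans apexWeight (cong (a +_) (sym (toℕ-fromℕ m)))
  weight-offset (suc u) with closedSum-offset (position-< (toℕ u))
  ... | x , x<m , s+x≡ = inject₁ (fromℕ<m x<m) , trans (weight≡a+offset (vertexWeight u) s+x≡)
                           (cong (a +_) (sym (trans (toℕ-inject₁ (fromℕ<m x<m)) (toℕ-fromℕ<m x<m))))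

  offset-weight : ∀ i → Σ[ u ∈ Fin (suc m) ] weight G f u ≡ a + toℕ i
  offset-weight i with toℕ i ≟ m
  ... | yes i≡m = zero , trans apexWeight (cong (a +_) (sym i≡m))
  ... | no  i≢m with offset-closedSum (subst (toℕ i <_) m≡suc (≤∧≢⇒< (s≤s⁻¹ (toℕ<n i)) i≢m))
  ...   | p , p<m , s+i≡ = suc u , weight≡a+offset (subst (λ q → weight G f (suc u) + (closedSum q + 3) ≡ _)
                                                          position-u (vertexWeight u)) s+i≡
    where
    u : Fin m
    u = fromℕ<m (position-< p)
    position-u : position (toℕ u) ≡ p
    position-u = trans (cong position (toℕ-fromℕ<m (position-< p))) (position-involutive p<m)

corollary4p7 : (n : ℕ) → DistanceAntimagic (join-K1 (H (suc n))) (ℤ.+ (8 * suc n * suc n + 14 * suc n + 6)) 1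
corollary4p7 n = f , offsets⇒isDistanceAntimagicLabeling G a bijective weight-offset offset-weight
  where open Labelling (suc n)
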